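{- Every circular arc graph $G$ which is not an interval graph has a dominating cycle $C$ (a cycle subgraph of $G$ such that every vertex of $G$ lies on $C$ or is adjacent to a vertex of $C$) whose diameter, as a graph, is at most $diam(G)$.
   Context: A circular arc graph is an intersection graph of arcs on a circle; an interval graph is an intersection graph of intervals on the real line. $diam(H)$ denotes the maximum distance between two vertices of a graph $H$. -}

module Defs where

open import Data.Nat using (ℕ; zero; suc; _+_; _∸_; _≤_; _<_; NonZero)
open import Data.Nat.DivMod using (_%_)
open import Data.Fin using (Fin; toℕ)
open import Data.Product using (Σ; ∃; _×_; _,_)
open import Relation.Binary.PropositionalEquality using (_≡_; _≢_)
open import Relation.Nullary using (¬_)
open import Function.Bundles using (_⇔_)
open import Function.Definitions using (Injective)

record Graph : Set₁ where
  field
    n   : ℕ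
    Adj : Fin n → Fin n → Set
open Graph public

record IsSimple (G : Graph) : Set where
  field
    sym     : ∀ {u v} → Adj G u v → Adj G v u
    irrefl  : ∀ {u} → ¬ Adj G u u

data Walk (G : Graph) : Fin (n G) → Fin (n G) → ℕ → Set where
  here  : ∀ {u} → Walk G u u 0
  step  : ∀ {u v w k} → Adj G u v → Walk G v w k → Walk G u w (suc k)

DistLe : (G : Graph) → Fin (n G) → Fin (n G) → ℕ → Set
DistLe G u v d = Σ ℕ λ m → m ≤ d × Walk G u v m

DiamLe : Graph → ℕ → Set
DiamLe G D = ∀ u v → DistLe G u v D

Connected : Graph → Set
Connected G = ∀ u v → Σ ℕ λ m → Walk G u v m

-- A finite family of closed arcs on a circle can
-- always be realized with endpoints among L equally spaced points, so the
-- circle is modelled as the discrete cycle of points Fin L, and an arc is a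
-- run of consecutive points (start, length) with 1 ≤ length ≤ L.

record Arc (L : ℕ) : Set where
  field
    start  : Fin L
    len    : ℕ
    len≥1  : 1 ≤ len
    len≤L  : len ≤ L
open Arc public

OnArc : ∀ {L} .{{_ : NonZero L}} → Arc L → Fin L → Set
OnArc {L} a p = ((toℕ p + L) ∸ toℕ (start a)) % L < len a

ArcsMeet : ∀ {L} .{{_ : NonZero L}} → Arc L → Arc L → Set
ArcsMeet a b = ∃ λ p → OnArc a p × OnArc b p

IsCircularArcGraph : Graph → Set
IsCircularArcGraph G =
  Σ ℕ λ L → Σ (NonZero L) λ nz → Σ (Fin (n G) → Arc L) λ arc →
    ∀ u v → u ≢ v → (Adj G u v ⇔ ArcsMeet {{nz}} (arc u) (arc v))

-- Interval graphs.  Closed intervals [lo, hi] on the line; a finite family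
-- can always be realized with natural-number endpoints.

record Interval : Set where
  field
    lo  : ℕ
    hi  : ℕ
    lo≤hi : lo ≤ hi
open Interval public

IntervalsMeet : Interval → Interval → Set
IntervalsMeet I J = ∃ λ x → (lo I ≤ x × x ≤ hi I) × (lo J ≤ x × x ≤ hi J)

IsIntervalGraph : Graph → Set
IsIntervalGraph G =
  Σ (Fin (n G) → Interval) λ iv →
    ∀ u v → u ≢ v → (Adj G u v ⇔ IntervalsMeet (iv u) (iv v))

CycleGraph : (k : ℕ) .{{_ : NonZero k}} → Graph
CycleGraph k = record
  { n = k
  ; Adj = λ i j → (toℕ j ≡ suc (toℕ i) % k) ⊎' (toℕ i ≡ suc (toℕ j) % k) }
  where
    open import Data.Sum renaming (_⊎_ to _⊎'_)

record CycleIn (G : Graph) : Set where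
  field
    extra     : ℕ
  clen : ℕ
  clen = 3 + extra
  field
    vert      : Fin clen → Fin (n G)
    injective : Injective _≡_ _≡_ vert
    edges     : ∀ (i j : Fin clen) → toℕ j ≡ suc (toℕ i) % clen → Adj G (vert i) (vert j)

Dominating : (G : Graph) → CycleIn G → Set
Dominating G C = ∀ v → ∃ λ i → (CycleIn.vert C i ≡ v) ⊎' Adj G v (CycleIn.vert C i)
  where open import Data.Sum renaming (_⊎_ to _⊎'_)

asGraph : ∀ {G} → CycleIn G → Graph
asGraph C = CycleGraph (3 + CycleIn.extra C)

DiamLeDiam : Graph → Graph → Set
DiamLeDiam H G = ∀ D → DiamLe G D → DiamLe H D

-- Unroll the circle onto ℕ, replacing each arc by its copies shifted by multiples of L. If some
-- point of the line and its successor lay in no common copy, cutting the circle there would give an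
-- interval model; so every point is spanned, and walking greedily to the right through overlapping
-- copies eventually revisits an arc a full turn further on: a loop. A shortest loop uses distinct
-- arcs, and it dominates G because its copies cover a whole turn. If G had a walk of length
-- l < ⌊m/2⌋ from the start of a shortest loop of length m ≥ 3 to its middle vertex, lifting that
-- walk would close a loop shorter than m with one of the two halves; hence ⌊m/2⌋, the diameter of
-- the m-cycle, is at most diam(G). A loop of length 2 closes into a triangle through a common
-- neighbour of its two arcs; if there is none, shortening one of the arcs exposes an unspanned
-- point without changing the graph, which again makes G an interval graph.

module Submission where

open import Defs
open import Data.Nat using (ℕ; zero; suc; _+_; _*_; _∸_; _≤_; _<_; z≤n; s≤s; s≤s⁻¹; NonZero; _%_; _≤?_; _<?_; pred; ⌊_/2⌋; ⌈_/2⌉; >-nonZero; >-nonZero⁻¹)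
open import Data.Nat.Properties
open import Data.Nat.Induction using (<-rec)
open import Data.Nat.DivMod using (_mod_; _/_; m≡m%n+[m/n]*n; m<n⇒m%n≡m; %-distribˡ-+; m%n%n≡m%n; [m+n]%n≡m%n; [m+kn]%n≡m%n; n%n≡0; m%n<n; m≥n⇒m/n>0)
open import Data.Nat.Tactic.RingSolver using (solve-∀)
open import Data.Fin using (Fin; zero; suc; toℕ; fromℕ<)
open import Data.Fin.Properties using (toℕ<n; toℕ-fromℕ<; toℕ-injective; any?; all?; pigeonhole) renaming (_≟_ to _≟ᶠ_)
open import Data.Product using (Σ; ∃; _×_; _,_; proj₁; proj₂)
open import Data.Sum using (_⊎_; inj₁; inj₂)
open import Relation.Binary.PropositionalEquality
open import Relation.Binary.Definitions using (tri<; tri≈; tri>)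
open import Data.Empty using (⊥; ⊥-elim)
open import Relation.Nullary using (¬_; Dec; yes; no)
open import Relation.Nullary.Decidable using (map′; _×-dec_; _⊎-dec_; ¬?)
open import Function.Bundles using (_⇔_; mk⇔; Equivalence)
open import Function.Base using (_∘_)

-- Walks and the cycle graph

Walk-++ : ∀ {G u v w a b} → Walk G u v a → Walk G v w b → Walk G u w (a + b)
Walk-++ here       q = q
Walk-++ (step e p) q = step e (Walk-++ p q)

Walk-reverse : ∀ {G} → (∀ {u v} → Adj G u v → Adj G v u) →
               ∀ {u v a} → Walk G u v a → Walk G v u a
Walk-reverse adj-sym here = here
Walk-reverse adj-sym {a = suc a} (step e p) =
  subst (Walk _ _ _) (+-comm a 1) (Walk-++ (Walk-reverse adj-sym p) (step (adj-sym e) here))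

module _ {G : Graph} (Adj? : ∀ u v → Dec (Adj G u v)) where

  Walk? : ∀ u v m → Dec (Walk G u v m)
  Walk? u v zero with u ≟ᶠ v
  ... | yes refl = yes here
  ... | no  u≢v  = no λ { here → u≢v refl }
  Walk? u v (suc m) = map′ (λ (w , e , p) → step e p) (λ { (step e p) → _ , e , p })
                           (any? λ w → Adj? u w ×-dec Walk? w v m)

  DistLe? : ∀ u v d → Dec (DistLe G u v d)
  DistLe? u v d = map′ (λ (m , m<1+d , p) → m , s≤s⁻¹ m<1+d , p) (λ (m , m≤d , p) → m , s≤s m≤d , p)
                       (anyUpTo? (Walk? u v) (suc d))

  DiamLe? : ∀ D → Dec (DiamLe G D)
  DiamLe? D = all? λ u → all? λ v → DistLe? u v D

DiamLe-mono : ∀ {G D D′} → D ≤ D′ → DiamLe G D → DiamLe G D′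
DiamLe-mono D≤D′ diam u v with diam u v
... | m , m≤D , p = m , ≤-trans m≤D D≤D′ , p

distinct⇒diam≥1 : ∀ {G x y D} → x ≢ y → DiamLe G D → 1 ≤ D
distinct⇒diam≥1 {x = x} {y} x≢y diam with diam x y
... | zero  , _   , here = ⊥-elim (x≢y refl)
... | suc _ , l≤D , _    = ≤-trans (s≤s z≤n) l≤D

≤-half⇒≤-double : ∀ {m D} → ⌊ m /2⌋ ≤ D → m ≤ suc (D + D)
≤-half⇒≤-double {m} {D} h≤D = begin
  m                          ≡⟨ ⌊n/2⌋+⌈n/2⌉≡n m ⟨
  ⌊ m /2⌋ + ⌈ m /2⌉          ≤⟨ +-monoʳ-≤ ⌊ m /2⌋ (⌊n/2⌋-mono (n≤1+n (suc m))) ⟩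
  ⌊ m /2⌋ + suc ⌊ m /2⌋      ≡⟨ +-suc ⌊ m /2⌋ ⌊ m /2⌋ ⟩
  suc (⌊ m /2⌋ + ⌊ m /2⌋)    ≤⟨ s≤s (+-mono-≤ h≤D h≤D) ⟩
  suc (D + D)                ∎
  where open ≤-Reasoning

half+half≤ : ∀ m → ⌊ m /2⌋ + ⌊ m /2⌋ ≤ m
half+half≤ m = ≤-trans (+-monoʳ-≤ ⌊ m /2⌋ (⌊n/2⌋≤⌈n/2⌉ m)) (≤-reflexive (⌊n/2⌋+⌈n/2⌉≡n m))

triangle : ∀ {G : Graph} {x y z} → x ≢ y → y ≢ z → z ≢ x → Adj G x y → Adj G y z → Adj G z x → CycleIn G
triangle {G} {x} {y} {z} x≢y y≢z z≢x xy yz zx = record { extra = 0 ; vert = vert ; injective = injective ; edges = edges }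
  where
  vert : Fin 3 → Fin (n G)
  vert zero             = x
  vert (suc zero)       = y
  vert (suc (suc zero)) = z

  injective : ∀ {i j} → vert i ≡ vert j → i ≡ j
  injective {zero}             {zero}             _  = refl
  injective {zero}             {suc zero}         eq = ⊥-elim (x≢y eq)
  injective {zero}             {suc (suc zero)}   eq = ⊥-elim (z≢x (sym eq))
  injective {suc zero}         {zero}             eq = ⊥-elim (x≢y (sym eq))
  injective {suc zero}         {suc zero}         _  = refl
  injective {suc zero}         {suc (suc zero)}   eq = ⊥-elim (y≢z eq)
  injective {suc (suc zero)}   {zero}             eq = ⊥-elim (z≢x eq)
  injective {suc (suc zero)}   {suc zero}         eq = ⊥-elim (y≢z (sym eq))
  injective {suc (suc zero)}   {suc (suc zero)}   _  = refl

  edges : ∀ i j → toℕ j ≡ suc (toℕ i) % 3 → Adj G (vert i) (vert j)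
  edges zero             (suc zero)       _ = xy
  edges (suc zero)       (suc (suc zero)) _ = yz
  edges (suc (suc zero)) zero             _ = zx
  edges zero             zero             ()
  edges zero             (suc (suc zero)) ()
  edges (suc zero)       zero             ()
  edges (suc zero)       (suc zero)       ()
  edges (suc (suc zero)) (suc zero)       ()
  edges (suc (suc zero)) (suc (suc zero)) ()

module _ (k : ℕ) .{{_ : NonZero k}} where

  private
    C = CycleGraph k

  cycle-sym : ∀ {i j} → Adj C i j → Adj C j i
  cycle-sym (inj₁ e) = inj₂ e
  cycle-sym (inj₂ e) = inj₁ e

  cycle-clockwise : ∀ (i j : Fin k) d → (toℕ i + d) % k ≡ toℕ j → Walk C i j d
  cycle-clockwise i j zero eq =
    subst (λ x → Walk C i x 0)
      (toℕ-injective (trans (sym (m<n⇒m%n≡m i<k)) (trans (cong (_% k) (sym (+-identityʳ (toℕ i)))) eq))) here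
    where i<k = toℕ<n i
  cycle-clockwise i j (suc d) eq = step (inj₁ (toℕ-fromℕ< _)) (cycle-clockwise i⁺ j d eq⁺)
    where
    i⁺ = fromℕ< (m%n<n (suc (toℕ i)) k)
    open ≡-Reasoning
    eq⁺ : (toℕ i⁺ + d) % k ≡ toℕ j
    eq⁺ = begin
      (toℕ i⁺ + d) % k           ≡⟨ cong (λ x → (x + d) % k) (toℕ-fromℕ< _) ⟩
      (suc (toℕ i) % k + d) % k  ≡⟨ %-distribˡ-+ (suc (toℕ i) % k) d k ⟩
      (suc (toℕ i) % k % k + d % k) % k ≡⟨ cong (λ x → (x + d % k) % k) (m%n%n≡m%n (suc (toℕ i)) k) ⟩
      (suc (toℕ i) % k + d % k) % k ≡⟨ %-distribˡ-+ (suc (toℕ i)) d k ⟨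
      (suc (toℕ i) + d) % k      ≡⟨ cong (_% k) (+-suc (toℕ i) d) ⟨
      (toℕ i + suc d) % k        ≡⟨ eq ⟩
      toℕ j ∎

  cycle-distLe-≤ : ∀ D → k ≤ suc (D + D) → ∀ (i j : Fin k) → toℕ i ≤ toℕ j →
                   DistLe C i j D × DistLe C j i D
  cycle-distLe-≤ D k≤ i j i≤j with toℕ j ∸ toℕ i ≤? D
  ... | yes d≤D = (d , d≤D , w) , (d , d≤D , Walk-reverse cycle-sym w)
    where
    d = toℕ j ∸ toℕ i
    w = cycle-clockwise i j d (trans (cong (_% k) (m+[n∸m]≡n i≤j)) (m<n⇒m%n≡m (toℕ<n j)))
  ... | no d≰D = (k ∸ d , k∸d≤D , Walk-reverse cycle-sym w) , (k ∸ d , k∸d≤D , w)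
    where
    d = toℕ j ∸ toℕ i
    d≤k = ≤-trans (m∸n≤m (toℕ j) (toℕ i)) (<⇒≤ (toℕ<n j))
    open ≡-Reasoning
    j+[k∸d]≡i+k : toℕ j + (k ∸ d) ≡ toℕ i + k
    j+[k∸d]≡i+k = begin
      toℕ j + (k ∸ d)          ≡⟨ cong (_+ (k ∸ d)) (m+[n∸m]≡n i≤j) ⟨
      toℕ i + d + (k ∸ d)      ≡⟨ +-assoc (toℕ i) d (k ∸ d) ⟩
      toℕ i + (d + (k ∸ d))    ≡⟨ cong (toℕ i +_) (m+[n∸m]≡n d≤k) ⟩
      toℕ i + k ∎
    w = cycle-clockwise j i (k ∸ d)
          (trans (cong (_% k) j+[k∸d]≡i+k) (trans ([m+n]%n≡m%n (toℕ i) k) (m<n⇒m%n≡m (toℕ<n i))))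
    k∸d≤D : k ∸ d ≤ D
    k∸d≤D = ≤-trans (∸-mono k≤ (≰⇒> d≰D)) (≤-reflexive (m+n∸n≡m D D))

  cycle-diamLe : ∀ D → k ≤ suc (D + D) → DiamLe C D
  cycle-diamLe D k≤ i j with toℕ i ≤? toℕ j
  ... | yes i≤j = proj₁ (cycle-distLe-≤ D k≤ i j i≤j)
  ... | no  i≰j = proj₂ (cycle-distLe-≤ D k≤ j i (<⇒≤ (≰⇒> i≰j)))

-- Arcs unrolled onto the line

arcsMeet-sym : ∀ {L} .{{_ : NonZero L}} {a b : Arc L} → ArcsMeet a b → ArcsMeet b a
arcsMeet-sym (p , p∈a , p∈b) = p , p∈b , p∈a

∸<⇒<+ : ∀ {m n o} → n ≤ m → m ∸ n < o → m < n + o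
∸<⇒<+ {m} {n} {o} n≤m lt = subst (_< n + o) (m+[n∸m]≡n n≤m) (+-monoʳ-< n lt)

<+⇒∸< : ∀ {m n o} → n ≤ m → m < n + o → m ∸ n < o
<+⇒∸< {m} {n} {o} n≤m lt = +-cancelˡ-< n (m ∸ n) o (subst (_< n + o) (sym (m+[n∸m]≡n n≤m)) lt)

module Unrolling (L : ℕ) .{{_ : NonZero L}} where

  -- Copy c of an arc a is the interval [c L + start a, c L + start a + len a) of ℕ; the lifts of a
  -- point p of the circle are the numbers p + j L.
  Copy : Set
  Copy = Arc L × ℕ

  lower : Copy → ℕ
  lower (a , c) = c * L + toℕ (start a)

  upper : Copy → ℕ
  upper (a , c) = lower (a , c) + len a

  infix 4 _∈_
  record _∈_ (X : ℕ) (A : Copy) : Set where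
    constructor mk∈
    field
      lower≤ : lower A ≤ X
      <upper : X < upper A

  Overlap : Copy → Copy → Set
  Overlap A B = ∃ λ X → X ∈ A × X ∈ B

  Spans : Copy → ℕ → Set
  Spans A X = lower A ≤ X × suc X < upper A

  Spans? : ∀ A X → Dec (Spans A X)
  Spans? A X = (lower A ≤? X) ×-dec (suc X <? upper A)

  overlap-sym : ∀ {A B} → Overlap A B → Overlap B A
  overlap-sym (X , X∈A , X∈B) = X , X∈B , X∈A

  lower<upper : ∀ A → lower A < upper A
  lower<upper (a , c) = m<m+n (lower (a , c)) (len≥1 a)

  lower-mono : ∀ a {c d} → c ≤ d → lower (a , c) ≤ lower (a , d)
  lower-mono a c≤d = +-monoˡ-≤ (toℕ (start a)) (*-monoˡ-≤ L c≤d)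

  upper-mono : ∀ a {c d} → c ≤ d → upper (a , c) ≤ upper (a , d)
  upper-mono a c≤d = +-monoˡ-≤ (len a) (lower-mono a c≤d)

  lower-suc : ∀ a c → lower (a , suc c) ≡ lower (a , c) + L
  lower-suc a c = rearrange c L (toℕ (start a))
    where
    rearrange : ∀ c L s → suc c * L + s ≡ c * L + s + L
    rearrange = solve-∀

  upper-suc : ∀ a c → upper (a , suc c) ≡ upper (a , c) + L
  upper-suc a c = trans (cong (_+ len a) (lower-suc a c)) (+-assoc-comm (lower (a , c)) L (len a))
    where
    +-assoc-comm : ∀ x y z → x + y + z ≡ x + z + y
    +-assoc-comm = solve-∀

  upper≤lower : ∀ a {c d} → c < d → upper (a , c) ≤ lower (a , d)
  upper≤lower a {c} {d} c<d = begin
    c * L + s + len a  ≤⟨ +-monoʳ-≤ (c * L + s) (len≤L a) ⟩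
    c * L + s + L      ≡⟨ rearrange c L s ⟩
    suc c * L + s      ≤⟨ +-monoˡ-≤ s (*-monoˡ-≤ L c<d) ⟩
    d * L + s          ∎
    where
    open ≤-Reasoning hiding (start)
    s = toℕ (start a)
    rearrange : ∀ c L s → c * L + s + L ≡ suc c * L + s
    rearrange = solve-∀

  lower-suc≤upper : ∀ a {c d} → c < d → lower (a , suc c) ≤ upper (a , d)
  lower-suc≤upper a {d = d} c<d = ≤-trans (lower-mono a c<d) (<⇒≤ (lower<upper (a , d)))

  copies-disjoint : ∀ a {c d} → c < d → ¬ Overlap (a , c) (a , d)
  copies-disjoint a c<d (X , mk∈ _ X<up , mk∈ low≤X _) = <⇒≱ X<up (≤-trans (upper≤lower a c<d) low≤X)

  gap-between-copies : ∀ a c {X} → upper (a , c) ≤ suc X → X < lower (a , suc c) → ∀ d → ¬ Spans (a , d) X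
  gap-between-copies a c {X} up≤ X<low d (low≤X , X+1<up) with d ≤? c
  ... | yes d≤c = <⇒≱ X+1<up (≤-trans (upper-mono a d≤c) up≤)
  ... | no  d≰c = <⇒≱ X<low (≤-trans (lower-mono a (≰⇒> d≰c)) low≤X)

  ¬spans⇒upper≤ : ∀ {A X} → lower A ≤ X → ¬ Spans A X → upper A ≤ suc X
  ¬spans⇒upper≤ {A} {X} low≤X ¬span with upper A ≤? suc X
  ... | yes up≤ = up≤
  ... | no  up≰ = ⊥-elim (¬span (low≤X , ≰⇒> up≰))

  ∈⇒≤pred-upper : ∀ {X A} → X ∈ A → X ≤ pred (upper A)
  ∈⇒≤pred-upper (mk∈ _ X<up) = <⇒≤pred X<up

  ≤pred-upper⇒∈ : ∀ {X A} → lower A ≤ X → X ≤ pred (upper A) → X ∈ A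
  ≤pred-upper⇒∈ {X} {A} low≤X X≤ =
    mk∈ low≤X (m≤pred[n]⇒suc[m]≤n {{>-nonZero (≤-<-trans z≤n (lower<upper A))}} X≤)

  lower-shift : ∀ a k c → lower (a , k + c) ≡ k * L + lower (a , c)
  lower-shift a k c = distrib k c L (toℕ (start a))
    where
    distrib : ∀ k c L s → (k + c) * L + s ≡ k * L + (c * L + s)
    distrib = solve-∀

  upper-shift : ∀ a k c → upper (a , k + c) ≡ k * L + upper (a , c)
  upper-shift a k c = trans (cong (_+ len a) (lower-shift a k c)) (+-assoc (k * L) (lower (a , c)) (len a))

  ∈-shift : ∀ k {a c X} → X ∈ (a , c) → k * L + X ∈ (a , k + c)
  ∈-shift k {a} {c} {X} (mk∈ low≤X X<up) = mk∈
    (subst (_≤ k * L + X) (sym (lower-shift a k c)) (+-monoʳ-≤ (k * L) low≤X))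
    (subst (k * L + X <_) (sym (upper-shift a k c)) (+-monoʳ-< (k * L) X<up))

  overlap-shift : ∀ k {a b c d} → Overlap (a , c) (b , d) → Overlap (a , k + c) (b , k + d)
  overlap-shift k (X , X∈a , X∈b) = k * L + X , ∈-shift k X∈a , ∈-shift k X∈b

  spans-shift : ∀ k {a c X} → Spans (a , c) X → Spans (a , k + c) (k * L + X)
  spans-shift k {a} {c} {X} (low≤X , 1+X<up) =
    subst (_≤ k * L + X) (sym (lower-shift a k c)) (+-monoʳ-≤ (k * L) low≤X) ,
    subst (suc (k * L + X) <_) (sym (upper-shift a k c))
      (subst (_< k * L + upper (a , c)) (+-suc (k * L) X) (+-monoʳ-< (k * L) 1+X<up))

  start<L : ∀ (a : Arc L) → toℕ (start a) < L
  start<L a = toℕ<n (start a)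

  offset-mod : ∀ {a c X} (p : Fin L) j → X ≡ toℕ p + j * L → lower (a , c) ≤ X → X ∸ lower (a , c) < L →
               ((toℕ p + L) ∸ toℕ (start a)) % L ≡ X ∸ lower (a , c)
  offset-mod {a} {c} {X} p j X≡ low≤X i<L = begin
    A % L                ≡⟨ [m+kn]%n≡m%n A j L ⟨
    (A + j * L) % L      ≡⟨ cong (_% L) A+jL≡ ⟩
    (i + suc c * L) % L  ≡⟨ [m+kn]%n≡m%n i (suc c) L ⟩
    i % L                ≡⟨ m<n⇒m%n≡m i<L ⟩
    i                    ∎
    where
    open ≡-Reasoning
    s = toℕ (start a)
    i = X ∸ lower (a , c)
    A = (toℕ p + L) ∸ s
    swap : ∀ x y z → x + y + z ≡ x + z + y
    swap = solve-∀
    unfold : ∀ c L s i → c * L + s + i + L ≡ i + suc c * L + s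
    unfold = solve-∀
    A+jL≡ : A + j * L ≡ i + suc c * L
    A+jL≡ = +-cancelʳ-≡ s _ _ (begin
      A + j * L + s            ≡⟨ swap A (j * L) s ⟩
      A + s + j * L            ≡⟨ cong (_+ j * L) (m∸n+n≡m (≤-trans (<⇒≤ (start<L a)) (m≤n+m L (toℕ p)))) ⟩
      toℕ p + L + j * L        ≡⟨ swap (toℕ p) L (j * L) ⟩
      toℕ p + j * L + L        ≡⟨ cong (_+ L) (trans (sym X≡) (sym (m+[n∸m]≡n low≤X))) ⟩
      c * L + s + i + L        ≡⟨ unfold c L s i ⟩
      i + suc c * L + s        ∎)

  onArc⇔∈ : ∀ {a c X} (p : Fin L) j → X ≡ toℕ p + j * L → lower (a , c) ≤ X → X < lower (a , c) + L →
            OnArc a p ⇔ X ∈ (a , c)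
  onArc⇔∈ {a} {c} {X} p j X≡ low≤X X<low+L = mk⇔
    (λ on → mk∈ low≤X (∸<⇒<+ low≤X (subst (_< len a) offset≡ on)))
    (λ (mk∈ _ X<up) → subst (_< len a) (sym offset≡) (<+⇒∸< low≤X X<up))
    where offset≡ = offset-mod {a} {c} p j X≡ low≤X (<+⇒∸< low≤X X<low+L)

  ∈⇒onArc : ∀ {a c X} (p : Fin L) j → X ≡ toℕ p + j * L → X ∈ (a , c) → OnArc a p
  ∈⇒onArc {a} {c} p j X≡ X∈@(mk∈ low≤X X<up) =
    Equivalence.from (onArc⇔∈ {a} {c} p j X≡ low≤X (<-≤-trans X<up (+-monoʳ-≤ (lower (a , c)) (len≤L a)))) X∈

  onArc⇒∈₀ : ∀ {a} (p : Fin L) → OnArc a p → toℕ p ∈ (a , 0) ⊎ toℕ p + L ∈ (a , 0)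
  onArc⇒∈₀ {a} p on with toℕ (start a) ≤? toℕ p
  ... | yes s≤p = inj₁ (Equivalence.to (onArc⇔∈ {a} {0} p 0 (sym (+-identityʳ (toℕ p))) s≤p
                          (<-≤-trans (toℕ<n p) (m≤n+m L _))) on)
  ... | no  s≰p = inj₂ (Equivalence.to (onArc⇔∈ {a} {0} p 1 (cong (toℕ p +_) (sym (+-identityʳ L)))
                          (≤-trans (<⇒≤ (start<L a)) (m≤n+m L (toℕ p))) (+-monoˡ-< L (≰⇒> s≰p))) on)

  representative : ∀ a c (p : Fin L) → ∃ λ j → lower (a , c) ≤ toℕ p + j * L × toℕ p + j * L < lower (a , suc c)
  representative a c p with toℕ (start a) ≤? toℕ p
  ... | yes s≤p = c , lower≤ , <lower
    where
    open ≤-Reasoning hiding (start)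
    lower≤ = begin
      c * L + toℕ (start a)      ≤⟨ +-monoʳ-≤ (c * L) s≤p ⟩
      c * L + toℕ p              ≡⟨ +-comm (c * L) (toℕ p) ⟩
      toℕ p + c * L              ∎
    <lower = begin-strict
      toℕ p + c * L              <⟨ +-monoˡ-< (c * L) (toℕ<n p) ⟩
      L + c * L                  ≤⟨ m≤m+n (L + c * L) (toℕ (start a)) ⟩
      suc c * L + toℕ (start a)  ∎
  ... | no  s≰p = suc c , lower≤ , <lower
    where
    open ≤-Reasoning hiding (start)
    lower≤ = begin
      c * L + toℕ (start a)      ≤⟨ +-monoʳ-≤ (c * L) (<⇒≤ (start<L a)) ⟩
      c * L + L                  ≡⟨ +-comm (c * L) L ⟩
      L + c * L                  ≤⟨ m≤n+m (L + c * L) (toℕ p) ⟩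
      toℕ p + suc c * L          ∎
    <lower = begin-strict
      toℕ p + suc c * L          ≡⟨ +-comm (toℕ p) (suc c * L) ⟩
      suc c * L + toℕ p          <⟨ +-monoʳ-< (suc c * L) (≰⇒> s≰p) ⟩
      suc c * L + toℕ (start a)  ∎

  onArc⇒∈ : ∀ {a} (p : Fin L) → OnArc a p → ∀ c → ∃ λ j → toℕ p + j * L ∈ (a , c)
  onArc⇒∈ {a} p on c with representative a c p
  ... | j , low≤ , <next =
    j , Equivalence.to (onArc⇔∈ {a} {c} p j refl low≤ (subst (toℕ p + j * L <_) (lower-suc a c) <next)) on

  onArc-start : ∀ a → OnArc a (start a)
  onArc-start a = subst (_< len a) (sym (trans (cong (_% L) (m+n∸m≡n (toℕ (start a)) L)) (n%n≡0 L))) (len≥1 a)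

  lift-mod : ∀ X → X ≡ toℕ (X mod L) + X / L * L
  lift-mod X = trans (m≡m%n+[m/n]*n X L) (cong (_+ X / L * L) (sym (toℕ-fromℕ< (m%n<n X L))))

  overlap⇒arcsMeet : ∀ {a b c d} → Overlap (a , c) (b , d) → ArcsMeet a b
  overlap⇒arcsMeet (X , X∈a , X∈b) =
    X mod L , ∈⇒onArc (X mod L) (X / L) (lift-mod X) X∈a , ∈⇒onArc (X mod L) (X / L) (lift-mod X) X∈b

  arcsMeet⇒overlap : ∀ {a b} → ArcsMeet a b → ∀ c → ∃ λ c′ → c ≤ c′ × Overlap (a , suc c) (b , c′)
  arcsMeet⇒overlap {a} {b} (p , p∈a , p∈b) c with base
    where
    L+p≡p+L : 1 * L + toℕ p ≡ toℕ p + L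
    L+p≡p+L = trans (cong (_+ toℕ p) (+-identityʳ L)) (+-comm L (toℕ p))
    base : ∃ λ d → Overlap (a , 1) (b , d)
    base with onArc⇒∈₀ p p∈a | onArc⇒∈₀ p p∈b
    ... | inj₁ pa | inj₁ pb = 1 , overlap-shift 1 (toℕ p , pa , pb)
    ... | inj₁ pa | inj₂ pb = 0 , toℕ p + L , subst (_∈ (a , 1)) L+p≡p+L (∈-shift 1 pa) , pb
    ... | inj₂ pa | inj₁ pb = 2 , overlap-shift 1 (toℕ p + L , pa , subst (_∈ (b , 1)) L+p≡p+L (∈-shift 1 pb))
    ... | inj₂ pa | inj₂ pb = 1 , overlap-shift 1 (toℕ p + L , pa , pb)
  ... | d , o = c + d , m≤m+n c d , subst (λ x → Overlap (a , x) (b , c + d)) (+-comm c 1) (overlap-shift c o)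

-- Cutting the circle at a point no arc passes over leaves a family of intervals with the same
-- intersection pattern: each arc is cut out in the copy lying in the window (q, q + L] of the line.
module Cut {G : Graph} {L : ℕ} .{{_ : NonZero L}} (arc : Fin (n G) → Arc L)
           (model : ∀ u v → u ≢ v → Adj G u v ⇔ ArcsMeet (arc u) (arc v))
           (q : ℕ) (q<L : q < L) (uncrossed : ∀ u c → ¬ Unrolling.Spans L (arc u , c) (q + L)) where

  open Unrolling L

  cut-copy : Fin (n G) → ℕ
  cut-copy u with q <? toℕ (start (arc u))
  ... | yes _ = 0
  ... | no  _ = 1

  cut : Fin (n G) → Copy
  cut u = arc u , cut-copy u

  cut-bounds : ∀ u → q < lower (cut u) × lower (cut u) ≤ q + L
  cut-bounds u with q <? toℕ (start (arc u))
  ... | yes q<s = q<s , ≤-trans (<⇒≤ (start<L (arc u))) (m≤n+m L q)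
  ... | no  q≮s = subst (q <_) (sym lower≡) (<-≤-trans q<L (m≤n+m L _)) ,
                  subst (_≤ q + L) (sym lower≡) (+-monoˡ-≤ L (≮⇒≥ q≮s))
    where
    lower≡ : 1 * L + toℕ (start (arc u)) ≡ toℕ (start (arc u)) + L
    lower≡ = trans (cong (_+ toℕ (start (arc u))) (*-identityˡ L)) (+-comm L _)

  cut-upper : ∀ u → upper (cut u) ≤ suc (q + L)
  cut-upper u = ¬spans⇒upper≤ {cut u} (proj₂ (cut-bounds u)) (uncrossed u (cut-copy u))

  rep : Fin L → ℕ
  rep p with q <? toℕ p
  ... | yes _ = toℕ p
  ... | no  _ = toℕ p + L

  rep-bounds : ∀ p → q < rep p × rep p ≤ q + L
  rep-bounds p with q <? toℕ p
  ... | yes q<p = q<p , ≤-trans (<⇒≤ (toℕ<n p)) (m≤n+m L q)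
  ... | no  q≮p = <-≤-trans q<L (m≤n+m L (toℕ p)) , +-monoˡ-≤ L (≮⇒≥ q≮p)

  rep-lift : ∀ p → ∃ λ j → rep p ≡ toℕ p + j * L
  rep-lift p with q <? toℕ p
  ... | yes _ = 0 , sym (+-identityʳ (toℕ p))
  ... | no  _ = 1 , cong (toℕ p +_) (sym (+-identityʳ L))

  onArc⇒rep∈cut : ∀ u p → OnArc (arc u) p → rep p ∈ cut u
  onArc⇒rep∈cut u p on with rep-lift p | rep-bounds p | cut-bounds u
  ... | j , rep≡ | q<rep , rep≤ | q<low , low≤ with rep p <? lower (cut u)
  ... | no  rep≮low = Equivalence.to (onArc⇔∈ {arc u} {cut-copy u} p j rep≡ (≮⇒≥ rep≮low)
                        (<-≤-trans (s≤s rep≤) (+-monoˡ-≤ L q<low))) on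
  ... | yes rep<low =
    ⊥-elim (<⇒≱ q<rep (+-cancelʳ-≤ L (rep p) q (s≤s⁻¹ (≤-trans (_∈_.<upper repL∈) (cut-upper u)))))
    where
    rep+L≡ : rep p + L ≡ toℕ p + suc j * L
    rep+L≡ = trans (cong (_+ L) rep≡) (trans (+-assoc (toℕ p) (j * L) L) (cong (toℕ p +_) (+-comm (j * L) L)))
    repL∈ : rep p + L ∈ cut u
    repL∈ = Equivalence.to (onArc⇔∈ {arc u} {cut-copy u} p (suc j) rep+L≡
              (≤-trans low≤ (+-monoˡ-≤ L (<⇒≤ q<rep)))
              (+-monoˡ-< L rep<low)) on

  ∈cut⇒onArc : ∀ u X → X ∈ cut u → OnArc (arc u) (X mod L)
  ∈cut⇒onArc u X = ∈⇒onArc {arc u} {cut-copy u} (X mod L) (X / L) (lift-mod X)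

  interval : Fin (n G) → Interval
  interval u = record { lo = lower (cut u) ; hi = pred (upper (cut u)) ; lo≤hi = <⇒≤pred (lower<upper (cut u)) }

  isIntervalGraph : IsIntervalGraph G
  isIntervalGraph = interval , λ u v u≢v → mk⇔
    (λ adj → let (p , p∈u , p∈v) = Equivalence.to (model u v u≢v) adj
                 rep∈u = onArc⇒rep∈cut u p p∈u
                 rep∈v = onArc⇒rep∈cut v p p∈v
             in rep p , (_∈_.lower≤ rep∈u , ∈⇒≤pred-upper rep∈u) ,
                        (_∈_.lower≤ rep∈v , ∈⇒≤pred-upper rep∈v))
    (λ (x , (lo≤x , x≤hi) , (lo≤x′ , x≤hi′)) → Equivalence.from (model u v u≢v)
       (x mod L , ∈cut⇒onArc u x (≤pred-upper⇒∈ lo≤x x≤hi) ,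
                  ∈cut⇒onArc v x (≤pred-upper⇒∈ lo≤x′ x≤hi′)))

-- Chains of overlapping copies

module Chains {L : ℕ} .{{_ : NonZero L}} {N : ℕ} (arc : Fin N → Arc L) where

  open Unrolling L

  Lift : Set
  Lift = Fin N × ℕ

  copy : Lift → Copy
  copy (u , c) = arc u , c

  infixr 5 _∷_
  data Chain : Lift → Lift → ℕ → Set where
    []  : ∀ {A} → Chain A A 0
    _∷_ : ∀ {A B C m} → Overlap (copy A) (copy B) → Chain B C m → Chain A C (suc m)

  vertex : ∀ {A B m} → Chain A B m → ℕ → Lift
  vertex {A} []      _       = A
  vertex {A} (_ ∷ _) zero    = A
  vertex     (_ ∷ P) (suc i) = vertex P i

  vertex-zero : ∀ {A B m} (P : Chain A B m) → vertex P 0 ≡ A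
  vertex-zero []      = refl
  vertex-zero (_ ∷ _) = refl

  vertex-last : ∀ {A B m} (P : Chain A B m) → vertex P m ≡ B
  vertex-last []      = refl
  vertex-last (_ ∷ P) = vertex-last P

  overlap-at : ∀ {A B m} (P : Chain A B m) → ∀ {i} → i < m →
               Overlap (copy (vertex P i)) (copy (vertex P (suc i)))
  overlap-at (o ∷ P) {zero}  _          = subst (λ B → Overlap _ (copy B)) (sym (vertex-zero P)) o
  overlap-at (_ ∷ P) {suc i} (s≤s i<m) = overlap-at P i<m

  prefix : ∀ {A B m} (P : Chain A B m) i → i ≤ m → Chain A (vertex P i) i
  prefix []      zero    _         = []
  prefix (_ ∷ _) zero    _         = []
  prefix (o ∷ P) (suc i) (s≤s i≤m) = o ∷ prefix P i i≤m

  suffix : ∀ {A B m} (P : Chain A B m) i → i ≤ m → Chain (vertex P i) B (m ∸ i)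
  suffix []      zero    _         = []
  suffix (o ∷ P) zero    _         = o ∷ P
  suffix (_ ∷ P) (suc i) (s≤s i≤m) = suffix P i i≤m

  segment : ∀ {A B m} (P : Chain A B m) {i j} → i ≤ j → j ≤ m → Chain (vertex P i) (vertex P j) (j ∸ i)
  segment P       {zero}  {j}     _         j≤m       =
    subst (λ A → Chain A (vertex P j) j) (sym (vertex-zero P)) (prefix P j j≤m)
  segment (_ ∷ P) {suc i} {suc j} (s≤s i≤j) (s≤s j≤m) = segment P i≤j j≤m

  infixr 5 _++_
  _++_ : ∀ {A B C m k} → Chain A B m → Chain B C k → Chain A C (m + k)
  []      ++ Q = Q
  (o ∷ P) ++ Q = o ∷ (P ++ Q)

  infixl 5 _∷ʳ_
  _∷ʳ_ : ∀ {A B C m} → Chain A B m → Overlap (copy B) (copy C) → Chain A C (suc m)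
  []      ∷ʳ o = o ∷ []
  (o′ ∷ P) ∷ʳ o = o′ ∷ (P ∷ʳ o)

  reverse : ∀ {A B m} → Chain A B m → Chain B A m
  reverse []      = []
  reverse (o ∷ P) = reverse P ∷ʳ overlap-sym o

  lift-shift : ℕ → Lift → Lift
  lift-shift k (u , c) = u , k + c

  shift : ∀ k {A B m} → Chain A B m → Chain (lift-shift k A) (lift-shift k B) m
  shift k []      = []
  shift k (o ∷ P) = overlap-shift k o ∷ shift k P

  chain-covers : ∀ {A B m} (P : Chain A B m) {X} → lower (copy A) ≤ X → X < upper (copy B) →
                 ∃ λ i → i ≤ m × X ∈ copy (vertex P i)
  chain-covers []                      low≤X X<up = 0 , z≤n , mk∈ low≤X X<up
  chain-covers {A} ((Y , Y∈A , Y∈B) ∷ P) {X} low≤X X<up with X <? upper (copy A)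
  ... | yes X<upA = 0 , z≤n , mk∈ low≤X X<upA
  ... | no  X≮upA
    with chain-covers P (≤-trans (_∈_.lower≤ Y∈B) (≤-trans (<⇒≤ (_∈_.<upper Y∈A)) (≮⇒≥ X≮upA))) X<up
  ...   | i , i≤m , X∈ = suc i , s≤s i≤m , X∈

  -- The chain comes back to its starting arc one or more turns further round the circle.
  record Loop (m : ℕ) : Set where
    field
      {base}      : Fin N
      {from to}   : ℕ
      from<to     : from < to
      chain       : Chain (base , from) (base , to) m

  loop : ∀ {A B m} → Chain A B m → proj₁ A ≡ proj₁ B → proj₂ A ≢ proj₂ B → Loop m
  loop {_ , a} {_ , b} P refl a≢b with <-cmp a b
  ... | tri< a<b _ _ = record { from<to = a<b ; chain = P }
  ... | tri≈ _ a≡b _ = ⊥-elim (a≢b a≡b)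
  ... | tri> _ _ b<a = record { from<to = b<a ; chain = reverse P }

  -- Two chains from u to w whose net windings differ: going out along one and back along the other
  -- winds round the circle.
  loop-of-chains : ∀ {u w a c a′ c′ m m′} → Chain (u , a) (w , c) m → Chain (u , a′) (w , c′) m′ →
                   c′ + a ≢ c + a′ → Loop (m + m′)
  loop-of-chains {u} {w} {a} {c} {a′} {c′} {m′ = m′} P Q ne =
    loop (shift c′ P ++ subst (λ x → Chain (w , x) (u , c + a′) m′) (+-comm c c′) (reverse (shift c Q))) refl ne

module Argument (G : Graph) (simple : IsSimple G) {L : ℕ} .{{_ : NonZero L}} (arc : Fin (n G) → Arc L)
                (model : ∀ u v → u ≢ v → Adj G u v ⇔ ArcsMeet (arc u) (arc v))
                (notInterval : ¬ IsIntervalGraph G) where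

  open Unrolling L
  open Chains arc
  open IsSimple simple renaming (sym to adj-sym; irrefl to adj-irrefl)

  N : ℕ
  N = n G

  adj⇒≢ : ∀ {u v} → Adj G u v → u ≢ v
  adj⇒≢ adj refl = adj-irrefl adj

  adj⇒arcsMeet : ∀ {u v} → Adj G u v → ArcsMeet (arc u) (arc v)
  adj⇒arcsMeet {u} {v} adj = Equivalence.to (model u v (adj⇒≢ adj)) adj

  arcsMeet⇒adj : ∀ {u v} → u ≢ v → ArcsMeet (arc u) (arc v) → Adj G u v
  arcsMeet⇒adj {u} {v} u≢v = Equivalence.from (model u v u≢v)

  Adj? : ∀ u v → Dec (Adj G u v)
  Adj? u v with u ≟ᶠ v
  ... | yes refl = no adj-irrefl
  ... | no  u≢v  = map′ (arcsMeet⇒adj u≢v) adj⇒arcsMeet (any? λ p → (_ <? _) ×-dec (_ <? _))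

  equal-or-adj : ∀ {x w} p → OnArc (arc x) p → OnArc (arc w) p → w ≡ x ⊎ Adj G x w
  equal-or-adj {x} {w} p p∈x p∈w with w ≟ᶠ x
  ... | yes w≡x = inj₁ w≡x
  ... | no  w≢x = inj₂ (arcsMeet⇒adj (λ x≡w → w≢x (sym x≡w)) (p , p∈x , p∈w))

  uncrossed⇒⊥ : ∀ {arc′ : Fin N → Arc L} → (∀ u v → u ≢ v → Adj G u v ⇔ ArcsMeet (arc′ u) (arc′ v)) →
                ∀ q → q < L → (∀ u c → ¬ Spans (arc′ u , c) (q + L)) → ⊥
  uncrossed⇒⊥ {arc′} model′ q q<L uncrossed = notInterval (Cut.isIntervalGraph {G} arc′ model′ q q<L uncrossed)

  Crossed : Fin L → Set
  Crossed q = ∃ λ u → Spans (arc u , 0) (toℕ q + L) ⊎ Spans (arc u , 1) (toℕ q + L)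

  crossed : ∀ q → Crossed q
  crossed q with any? (λ u → Spans? (arc u , 0) (toℕ q + L) ⊎-dec Spans? (arc u , 1) (toℕ q + L))
  ... | yes c = c
  ... | no ¬c = ⊥-elim (uncrossed⇒⊥ {arc} model (toℕ q) (toℕ<n q) uncrossed)
    where
    uncrossed : ∀ u c → ¬ Spans (arc u , c) (toℕ q + L)
    uncrossed u zero          span = ¬c (u , inj₁ span)
    uncrossed u (suc zero)    span = ¬c (u , inj₂ span)
    uncrossed u (suc (suc c)) (low≤ , _) = <⇒≱ (+-monoˡ-< L (toℕ<n q))
      (≤-trans (≤-trans (+-monoʳ-≤ L (m≤m+n L (c * L))) (m≤m+n _ (toℕ (start (arc u))))) low≤)

  shifted-lift≡ : ∀ {X q} k → X ≡ q + suc k * L → k * L + (q + L) ≡ X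
  shifted-lift≡ {X} {q} k X≡ = trans (rearrange k L q) (sym X≡)
    where
    rearrange : ∀ k L q → k * L + (q + L) ≡ q + suc k * L
    rearrange = solve-∀

  spanned : ∀ X → L ≤ X → ∃ λ A → Spans (copy A) X
  spanned X L≤X with X / L | lift-mod X | m≥n⇒m/n>0 L≤X
  ... | suc k | X≡ | _ with crossed (X mod L)
  ...   | u , inj₁ span = (u , k + 0) , subst (Spans (arc u , k + 0)) (shifted-lift≡ k X≡) (spans-shift k {arc u} span)
  ...   | u , inj₂ span = (u , k + 1) , subst (Spans (arc u , k + 1)) (shifted-lift≡ k X≡) (spans-shift k {arc u} span)

  unspanned⇒⊥ : ∀ {arc′ : Fin N → Arc L} → (∀ u v → u ≢ v → Adj G u v ⇔ ArcsMeet (arc′ u) (arc′ v)) →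
                ∀ X → L ≤ X → (∀ u c → ¬ Spans (arc′ u , c) X) → ⊥
  unspanned⇒⊥ {arc′} model′ X L≤X unspanned with X / L | lift-mod X | m≥n⇒m/n>0 L≤X
  ... | suc k | X≡ | _ = uncrossed⇒⊥ {arc′} model′ (toℕ (X mod L)) (toℕ<n (X mod L)) λ u c span →
          unspanned u (k + c) (subst (Spans (arc′ u , k + c)) (shifted-lift≡ k X≡) (spans-shift k {arc′ u} span))

  step-right : ∀ A → L < upper (copy A) → ∃ λ B → Overlap (copy A) (copy B) × upper (copy A) < upper (copy B)
  step-right A L<up with spanned (pred (upper (copy A))) (<⇒≤pred L<up)
  ... | B , low≤ , up< = B , (pred (upper (copy A)) , ∈A , mk∈ low≤ (<-trans (n<1+n _) up<)) , A<B
    where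
    instance
      _ = >-nonZero (≤-<-trans z≤n L<up)
    ∈A : pred (upper (copy A)) ∈ copy A
    ∈A = mk∈ (<⇒≤pred (lower<upper (copy A))) (subst (pred (upper (copy A)) <_) (suc-pred (upper (copy A))) (n<1+n _))
    A<B : upper (copy A) < upper (copy B)
    A<B = subst (_< upper (copy B)) (suc-pred (upper (copy A))) up<

  Beyond : Set
  Beyond = Σ Lift λ A → L < upper (copy A)

  advance : Beyond → Beyond
  advance (A , L<up) = proj₁ (step-right A L<up) , <-trans L<up (proj₂ (proj₂ (step-right A L<up)))

  greedy-beyond : ℕ → Beyond
  greedy-beyond zero    = proj₁ (spanned L ≤-refl) , <-trans (n<1+n L) (proj₂ (proj₂ (spanned L ≤-refl)))
  greedy-beyond (suc i) = advance (greedy-beyond i)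

  greedy : ℕ → Lift
  greedy i = proj₁ (greedy-beyond i)

  greedy-overlap : ∀ i → Overlap (copy (greedy i)) (copy (greedy (suc i)))
  greedy-overlap i = proj₁ (proj₂ (step-right (greedy i) (proj₂ (greedy-beyond i))))

  greedy-climbs : ∀ i → upper (copy (greedy i)) < upper (copy (greedy (suc i)))
  greedy-climbs i = proj₂ (proj₂ (step-right (greedy i) (proj₂ (greedy-beyond i))))

  greedy-ascending : ∀ {i j} → i < j → upper (copy (greedy i)) < upper (copy (greedy j))
  greedy-ascending {i} {suc j} i<1+j with m≤n⇒m<n∨m≡n (s≤s⁻¹ i<1+j)
  ... | inj₁ i<j  = <-trans (greedy-ascending i<j) (greedy-climbs j)
  ... | inj₂ refl = greedy-climbs i

  greedy-chain : ∀ i k → Chain (greedy i) (greedy (k + i)) k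
  greedy-chain i zero    = []
  greedy-chain i (suc k) =
    greedy-overlap i ∷ subst (λ j → Chain (greedy (suc i)) (greedy j) k) (+-suc k i) (greedy-chain (suc i) k)

  -- Among the first N + 1 greedy copies two belong to the same arc; being ever further right, they
  -- are different copies of it.
  initial-loop : ∃ Loop
  initial-loop with pigeonhole (n<1+n N) (λ i → proj₁ (greedy (toℕ i)))
  ... | i , j , i<j , same = toℕ j ∸ toℕ i , loop P same copies≢
    where
    P : Chain (greedy (toℕ i)) (greedy (toℕ j)) (toℕ j ∸ toℕ i)
    P = subst (λ x → Chain (greedy (toℕ i)) (greedy x) (toℕ j ∸ toℕ i)) (m∸n+n≡m (<⇒≤ i<j))
          (greedy-chain (toℕ i) (toℕ j ∸ toℕ i))
    copies≢ : proj₂ (greedy (toℕ i)) ≢ proj₂ (greedy (toℕ j))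
    copies≢ eq = <-irrefl (cong (λ A → upper (copy A)) (cong₂ _,_ same eq)) (greedy-ascending i<j)

  arcAt : ∀ {m} → Loop m → ℕ → Fin N
  arcAt lp i = proj₁ (vertex (Loop.chain lp) i)

  arcAt-zero : ∀ {m} (lp : Loop m) → arcAt lp 0 ≡ Loop.base lp
  arcAt-zero lp = cong proj₁ (vertex-zero (Loop.chain lp))

  loop-covers : ∀ {m} (lp : Loop m) → 0 < m → ∀ p → ∃ λ i → i < m × OnArc (arc (arcAt lp i)) p
  loop-covers {m} lp 0<m p with representative (arc (Loop.base lp)) (Loop.from lp) p
  ... | j , low≤ , <lower-next with chain-covers (Loop.chain lp) low≤
                                      (<-≤-trans <lower-next (lower-suc≤upper (arc (Loop.base lp)) (Loop.from<to lp)))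
  ... | i , i≤m , X∈ with m≤n⇒m<n∨m≡n i≤m
  ...   | inj₁ i<m  = i , i<m , ∈⇒onArc p j refl X∈
  ...   | inj₂ refl = 0 , 0<m , subst (λ w → OnArc (arc w) p) (sym (arcAt-zero lp))
                                  (∈⇒onArc p j refl (subst (λ V → _ ∈ copy V) (vertex-last (Loop.chain lp)) X∈))

  loop-dominates : ∀ {m} (lp : Loop m) → 0 < m → ∀ x → ∃ λ i → i < m × (arcAt lp i ≡ x ⊎ Adj G x (arcAt lp i))
  loop-dominates lp 0<m x with loop-covers lp 0<m (start (arc x))
  ... | i , i<m , on = i , i<m , equal-or-adj (start (arc x)) (onArc-start (arc x)) on

  lift-walk : ∀ {x y l} → Walk G x y l → ∀ a → l ≤ a → ∃ λ b → Chain (x , a) (y , b) l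
  lift-walk here         a       _         = a , []
  lift-walk (step adj W) (suc a) (s≤s l≤a) with arcsMeet⇒overlap (adj⇒arcsMeet adj) a
  ... | c , a≤c , o with lift-walk W c (≤-trans l≤a a≤c)
  ...   | b , P = b , o ∷ P

  Shorter : ℕ → Set
  Shorter m = ∃ λ m′ → m′ < m × Loop m′

  repeat⇒shorter : ∀ {m} (lp : Loop m) {i j} → i < j → j < m → arcAt lp i ≡ arcAt lp j → Shorter m
  repeat⇒shorter {m} lp {i} {j} i<j j<m same with proj₂ (vertex (Loop.chain lp) i) ≟ proj₂ (vertex (Loop.chain lp) j)
  ... | no copies≢ =
    j ∸ i , ≤-<-trans (m∸n≤m j i) j<m , loop (segment (Loop.chain lp) (<⇒≤ i<j) (<⇒≤ j<m)) same copies≢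
  ... | yes copies≡ = i + (m ∸ j) , shorter , record { from<to = Loop.from<to lp ; chain = prefix P i i≤m ++ suffix′ }
    where
    P = Loop.chain lp
    i≤m = <⇒≤ (<-trans i<j j<m)
    suffix′ : Chain (vertex P i) (Loop.base lp , Loop.to lp) (m ∸ j)
    suffix′ = subst (λ V → Chain V _ (m ∸ j)) (sym (cong₂ _,_ same copies≡)) (suffix P j (<⇒≤ j<m))
    shorter : i + (m ∸ j) < m
    shorter = subst (i + (m ∸ j) <_) (m+[n∸m]≡n (<⇒≤ j<m)) (+-monoˡ-< (m ∸ j) i<j)

  -- Lift a walk from the base of the loop to its middle vertex; compared with the two halves of the
  -- loop, its winding differs from at least one of them, which yields a loop of length below m.
  short-walk⇒shorter : ∀ {m} (lp : Loop m) {h l} → h + h ≤ m →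
                       Walk G (Loop.base lp) (arcAt lp h) l → l < h → Shorter m
  short-walk⇒shorter {m} lp {h} {l} h+h≤m W l<h with lift-walk W l ≤-refl
  ... | e , Q with e + Loop.from lp ≟ proj₂ (vertex (Loop.chain lp) h) + l
  ... | no  ne = h + l , <-≤-trans (+-monoʳ-< h l<h) h+h≤m , loop-of-chains (prefix (Loop.chain lp) h h≤m) Q ne
    where h≤m = ≤-trans (m≤m+n h h) h+h≤m
  ... | yes eq = (m ∸ h) + l , shorter , loop-of-chains (reverse (suffix (Loop.chain lp) h h≤m)) Q ne
    where
    h≤m = ≤-trans (m≤m+n h h) h+h≤m
    shorter : (m ∸ h) + l < m
    shorter = subst ((m ∸ h) + l <_) (m∸n+n≡m h≤m) (+-monoʳ-< (m ∸ h) l<h)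
    ne : e + Loop.to lp ≢ proj₂ (vertex (Loop.chain lp) h) + l
    ne eq′ = <-irrefl (trans eq (sym eq′)) (+-monoʳ-< e (Loop.from<to lp))

  -- Two arcs u, v closing a loop of length 2 without a common neighbour: trimming v to end where
  -- copy b of u begins changes no adjacency (anything meeting the cut-off part meets u as well),
  -- yet leaves the point just before that copy unspanned.
  module Trim {u v a y b} (o₀ : Overlap (arc u , a) (arc v , y)) (o₁ : Overlap (arc v , y) (arc u , b))
              (a<b : a < b) (0<a : 0 < a) (lonely : ∀ w → w ≢ u → w ≢ v → Adj G w u → Adj G w v → ⊥) where

    T : ℕ
    T = lower (arc u , b)

    Y = proj₁ o₀
    Y∈u = proj₁ (proj₂ o₀)
    Y∈v = proj₂ (proj₂ o₀)

    upperU≤T : upper (arc u , a) ≤ T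
    upperU≤T = upper≤lower (arc u) a<b

    lowerV<upperU : lower (arc v , y) < upper (arc u , a)
    lowerV<upperU = ≤-<-trans (_∈_.lower≤ Y∈v) (_∈_.<upper Y∈u)

    lowerV<T : lower (arc v , y) < T
    lowerV<T = <-≤-trans lowerV<upperU upperU≤T

    T<upperV : T < upper (arc v , y)
    T<upperV = ≤-<-trans (_∈_.lower≤ (proj₂ (proj₂ o₁))) (_∈_.<upper (proj₁ (proj₂ o₁)))

    upperV≤upperU : upper (arc v , y) ≤ upper (arc u , b)
    upperV≤upperU = begin
      upper (arc v , y)            ≤⟨ +-monoʳ-≤ (lower (arc v , y)) (len≤L (arc v)) ⟩
      lower (arc v , y) + L        ≤⟨ +-monoˡ-≤ L (<⇒≤ lowerV<upperU) ⟩
      upper (arc u , a) + L        ≡⟨ upper-suc (arc u) a ⟨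
      upper (arc u , suc a)        ≤⟨ upper-mono (arc u) a<b ⟩
      upper (arc u , b)            ∎
      where open ≤-Reasoning hiding (start)

    trimmed-len≤ : T ∸ lower (arc v , y) ≤ len (arc v)
    trimmed-len≤ = subst (T ∸ lower (arc v , y) ≤_) (m+n∸m≡n (lower (arc v , y)) (len (arc v)))
                     (∸-monoˡ-≤ (lower (arc v , y)) (<⇒≤ T<upperV))

    trimmed : Arc L
    trimmed = record
      { start = start (arc v) ; len = T ∸ lower (arc v , y)
      ; len≥1 = m<n⇒0<n∸m lowerV<T ; len≤L = ≤-trans trimmed-len≤ (len≤L (arc v)) }

    upper-trimmed : upper (trimmed , y) ≡ T
    upper-trimmed = m+[n∸m]≡n (<⇒≤ lowerV<T)

    trimmed⊆ : ∀ p → OnArc trimmed p → OnArc (arc v) p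
    trimmed⊆ p on = <-≤-trans on trimmed-len≤

    onTrimmed : ∀ {X} (p : Fin L) j → X ≡ toℕ p + j * L → X ∈ (arc v , y) → X < T → OnArc trimmed p
    onTrimmed {X} p j X≡ (mk∈ low≤X _) X<T =
      ∈⇒onArc {trimmed} {y} p j X≡ (mk∈ low≤X (subst (X <_) (sym upper-trimmed) X<T))

    trimmed-meets : ∀ z → z ≢ v → Adj G v z → ArcsMeet trimmed (arc z)
    trimmed-meets z z≢v adj with z ≟ᶠ u
    ... | yes refl = Y mod L , onTrimmed (Y mod L) (Y / L) (lift-mod Y) Y∈v (<-≤-trans (_∈_.<upper Y∈u) upperU≤T) ,
                     ∈⇒onArc (Y mod L) (Y / L) (lift-mod Y) Y∈u
    trimmed-meets z z≢v adj | no z≢u with adj⇒arcsMeet adj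
    ... | p , p∈v , p∈z with onArc⇒∈ p p∈v y
    ...   | j , X∈v with toℕ p + j * L <? T
    ...     | yes X<T = p , onTrimmed p j refl X∈v X<T , p∈z
    ...     | no  X≮T = ⊥-elim (lonely z z≢u z≢v (arcsMeet⇒adj z≢u (p , p∈z , p∈u)) (adj-sym adj))
      where p∈u = ∈⇒onArc {arc u} {b} p j refl (mk∈ (≮⇒≥ X≮T) (<-≤-trans (_∈_.<upper X∈v) upperV≤upperU))

    adj-v⇔ : ∀ z → z ≢ v → Adj G v z ⇔ ArcsMeet trimmed (arc z)
    adj-v⇔ z z≢v = mk⇔ (trimmed-meets z z≢v)
                       (λ (p , p∈t , p∈z) → arcsMeet⇒adj (z≢v ∘ sym) (p , trimmed⊆ p p∈t , p∈z))

    arc′ : Fin N → Arc L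
    arc′ x with x ≟ᶠ v
    ... | yes _ = trimmed
    ... | no  _ = arc x

    model′ : ∀ x z → x ≢ z → Adj G x z ⇔ ArcsMeet (arc′ x) (arc′ z)
    model′ x z x≢z with x ≟ᶠ v | z ≟ᶠ v
    ... | yes refl | yes refl = ⊥-elim (x≢z refl)
    ... | yes refl | no  z≢v  = adj-v⇔ z z≢v
    ... | no  x≢v  | yes refl = mk⇔
      (λ adj → arcsMeet-sym {a = trimmed} {arc x} (Equivalence.to (adj-v⇔ x x≢v) (adj-sym adj)))
      (λ meet → adj-sym (Equivalence.from (adj-v⇔ x x≢v) (arcsMeet-sym {a = arc x} {trimmed} meet)))
    ... | no  _    | no  _    = model x z x≢z

    L<T : L < T
    L<T = begin-strict
      L                        <⟨ m<m+n L (>-nonZero⁻¹ L) ⟩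
      L + L                    ≡⟨ cong (L +_) (+-identityʳ L) ⟨
      2 * L                    ≤⟨ *-monoˡ-≤ L (≤-trans (s≤s 0<a) a<b) ⟩
      b * L                    ≤⟨ m≤m+n (b * L) _ ⟩
      T                        ∎
      where open ≤-Reasoning hiding (start)

    instance
      _ = >-nonZero (≤-<-trans z≤n L<T)

    predT<T : pred T < T
    predT<T = subst (pred T <_) (suc-pred T) (n<1+n _)

    unspanned : ∀ x c → ¬ Spans (arc′ x , c) (pred T)
    unspanned x c with x ≟ᶠ v
    ... | yes refl = gap-between-copies trimmed y (≤-reflexive (trans upper-trimmed (sym (suc-pred T))))
                       (<-trans predT<T (<-≤-trans T<upperV (upper≤lower (arc v) (n<1+n y)))) c
    ... | no  x≢v with x ≟ᶠ u
    ...   | yes refl = gap-between-copies (arc u) (pred b)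
                         (≤-trans (upper≤lower (arc u) (n<1+n (pred b))) (≤-reflexive (trans lower-b≡ (sym (suc-pred T)))))
                         (subst (pred T <_) (sym lower-b≡) predT<T) c
      where
      lower-b≡ : lower (arc u , suc (pred b)) ≡ T
      lower-b≡ = cong (λ c → lower (arc u , c)) (suc-pred b {{>-nonZero (≤-<-trans z≤n a<b)}})
    ...   | no  x≢u = λ (low≤ , up<) → lonely x x≢u x≢v
              (arcsMeet⇒adj x≢u (overlap⇒arcsMeet {arc x} {arc u} {c} {b}
                (T , mk∈ (≤-trans low≤ pred[n]≤n) (subst (_< upper (arc x , c)) (suc-pred T) up<) ,
                     mk∈ ≤-refl (lower<upper (arc u , b)))))
              (arcsMeet⇒adj x≢v (overlap⇒arcsMeet {arc x} {arc v} {c} {y}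
                (pred T , mk∈ low≤ (<-trans (n<1+n _) up<) ,
                          mk∈ (<⇒≤pred lowerV<T) (<-trans predT<T T<upperV))))

    contradiction : ⊥
    contradiction = unspanned⇒⊥ {arc′} model′ (pred T) (<⇒≤pred L<T) unspanned

  no-loop₀ : ¬ Loop 0
  no-loop₀ record { from<to = a<a ; chain = [] } = <-irrefl refl a<a

  no-loop₁ : ¬ Loop 1
  no-loop₁ record { from<to = a<b ; chain = o ∷ [] } = copies-disjoint _ a<b o

  Repeats : ∀ {m} → Loop m → Set
  Repeats {m} lp = ∃ λ j → j < m × ∃ λ i → i < j × arcAt lp i ≡ arcAt lp j

  Repeats? : ∀ {m} (lp : Loop m) → Dec (Repeats lp)
  Repeats? {m} lp = anyUpTo? (λ j → anyUpTo? (λ i → arcAt lp i ≟ᶠ arcAt lp j) j) m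

  arcAt-injective : ∀ {m} (lp : Loop m) → ¬ Repeats lp →
                    ∀ {i j} → i < m → j < m → arcAt lp i ≡ arcAt lp j → i ≡ j
  arcAt-injective lp norep {i} {j} i<m j<m same with <-cmp i j
  ... | tri< i<j _ _ = ⊥-elim (norep (j , j<m , i , i<j , same))
  ... | tri≈ _ i≡j _ = i≡j
  ... | tri> _ _ j<i = ⊥-elim (norep (i , i<m , j , j<i , sym same))

  arcAt-last : ∀ {m} (lp : Loop m) → arcAt lp m ≡ arcAt lp 0
  arcAt-last lp = trans (cong proj₁ (vertex-last (Loop.chain lp))) (sym (arcAt-zero lp))

  arcAt-next : ∀ {m} .{{_ : NonZero m}} (lp : Loop m) {i} → i < m → arcAt lp (suc i % m) ≡ arcAt lp (suc i)
  arcAt-next {m} lp {i} i<m with m≤n⇒m<n∨m≡n i<m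
  ... | inj₁ 1+i<m = cong (arcAt lp) (m<n⇒m%n≡m 1+i<m)
  ... | inj₂ refl  = trans (cong (arcAt lp) (n%n≡0 (suc i))) (sym (arcAt-last lp))

  next≢ : ∀ {m i} .{{_ : NonZero m}} → 1 < m → i < m → i ≢ suc i % m
  next≢ {m} {i} 1<m i<m i≡ with m≤n⇒m<n∨m≡n i<m
  ... | inj₁ 1+i<m = <-irrefl (trans i≡ (m<n⇒m%n≡m 1+i<m)) (n<1+n i)
  ... | inj₂ refl  = <-irrefl refl (subst (λ k → 1 < suc k) (trans i≡ (n%n≡0 (suc i))) 1<m)

  loop-adjacent : ∀ {m} .{{_ : NonZero m}} (lp : Loop m) → ¬ Repeats lp → 1 < m →
                  ∀ {i} → i < m → Adj G (arcAt lp i) (arcAt lp (suc i % m))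
  loop-adjacent {m} lp norep 1<m {i} i<m =
    arcsMeet⇒adj (next≢ 1<m i<m ∘ arcAt-injective lp norep i<m (m%n<n (suc i) m))
      (subst (λ w → ArcsMeet (arc (arcAt lp i)) (arc w)) (sym (arcAt-next lp i<m))
        (overlap⇒arcsMeet (overlap-at (Loop.chain lp) i<m)))

  loop-cycle : ∀ {e} (lp : Loop (3 + e)) → ¬ Repeats lp → CycleIn G
  loop-cycle {e} lp norep = record
    { extra     = e
    ; vert      = λ i → arcAt lp (toℕ i)
    ; injective = λ same → toℕ-injective (arcAt-injective lp norep (toℕ<n _) (toℕ<n _) same)
    ; edges     = λ i j j≡ → subst (λ k → Adj G _ (arcAt lp k)) (sym j≡)
                                  (loop-adjacent lp norep (s≤s (s≤s z≤n)) (toℕ<n i))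
    }

  loop-cycle-dominating : ∀ {e} (lp : Loop (3 + e)) (norep : ¬ Repeats lp) → Dominating G (loop-cycle lp norep)
  loop-cycle-dominating lp norep x with loop-dominates lp (s≤s z≤n) x
  ... | i , i<m , r = fromℕ< i<m , subst (λ k → arcAt lp k ≡ x ⊎ Adj G x (arcAt lp k)) (sym (toℕ-fromℕ< i<m)) r

  DominatingCycle : Set
  DominatingCycle = Σ (CycleIn G) λ C → Dominating G C × DiamLeDiam (asGraph C) G

  Recurse : ℕ → Set
  Recurse m = ∀ {m′} → m′ < m → Loop m′ → DominatingCycle

  -- A loop of length m ≥ 3 either has a short cut through G — making it shorter — or is itself a
  -- cycle of diameter ⌊m/2⌋ ≤ diam(G).
  from-long-loop : ∀ {e} (lp : Loop (3 + e)) → ¬ Repeats lp → Recurse (3 + e) → DominatingCycle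
  from-long-loop {e} lp norep recurse with DiamLe? Adj? ⌊ suc e /2⌋
  ... | yes diam with diam (Loop.base lp) (arcAt lp ⌊ 3 + e /2⌋)
  ...   | l , l≤ , W with short-walk⇒shorter lp (half+half≤ (3 + e)) W (s≤s l≤)
  ...     | _ , shorter , lp′ = recurse shorter lp′
  from-long-loop {e} lp norep recurse | no ¬diam =
    loop-cycle lp norep , loop-cycle-dominating lp norep ,
    λ D diam → cycle-diamLe (3 + e) D (≤-half⇒≤-double (D≥ D diam))
    where
    D≥ : ∀ D → DiamLe G D → ⌊ 3 + e /2⌋ ≤ D
    D≥ D diam with ⌊ 3 + e /2⌋ ≤? D
    ... | yes h≤D = h≤D
    ... | no  h≰D = ⊥-elim (¬diam (DiamLe-mono (s≤s⁻¹ (≰⇒> h≰D)) diam))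

  common-neighbour : ∀ (lp : Loop 2) → arcAt lp 0 ≢ arcAt lp 1 →
                     ∃ λ w → w ≢ arcAt lp 0 × w ≢ arcAt lp 1 × Adj G w (arcAt lp 0) × Adj G w (arcAt lp 1)
  common-neighbour record { from<to = a<b ; chain = o₀ ∷ o₁ ∷ [] } u≢v
    with any? (λ w → ¬? (w ≟ᶠ _) ×-dec ¬? (w ≟ᶠ _) ×-dec Adj? w _ ×-dec Adj? w _)
  ... | yes found = found
  -- Shifted one turn to the right, so that the unspanned point lies beyond L.
  ... | no  none  = ⊥-elim (Trim.contradiction (overlap-shift 1 o₀) (overlap-shift 1 o₁) (s≤s a<b) (s≤s z≤n)
                              λ w w≢u w≢v wu wv → none (w , w≢u , w≢v , wu , wv))

  first-two-distinct : ∀ {m} (lp : Loop (2 + m)) → ¬ Repeats lp → arcAt lp 0 ≢ arcAt lp 1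
  first-two-distinct lp norep same = norep (1 , s≤s (s≤s z≤n) , 0 , s≤s z≤n , same)

  from-2-loop : (lp : Loop 2) → ¬ Repeats lp → DominatingCycle
  from-2-loop lp norep with common-neighbour lp (first-two-distinct lp norep)
  ... | w , w≢u , w≢v , wu , wv =
    C , dominating , λ D diam → cycle-diamLe 3 D (s≤s (+-mono-≤ (D≥1 diam) (D≥1 diam)))
    where
    C = triangle (first-two-distinct lp norep) (w≢v ∘ sym) w≢u
          (loop-adjacent lp norep (s≤s (s≤s z≤n)) (s≤s z≤n)) (adj-sym wv) wu
    D≥1 : ∀ {D} → DiamLe G D → 1 ≤ D
    D≥1 = distinct⇒diam≥1 w≢u
    dominating : Dominating G C
    dominating x with loop-dominates lp (s≤s z≤n) x
    ... | zero        , _            , r = zero , r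
    ... | suc zero    , _            , r = suc zero , r
    ... | suc (suc _) , s≤s (s≤s ()) , _

  from-loop : ∀ m → Recurse m → Loop m → DominatingCycle
  from-loop zero       _ lp = ⊥-elim (no-loop₀ lp)
  from-loop (suc zero) _ lp = ⊥-elim (no-loop₁ lp)
  from-loop (suc (suc m)) recurse lp with Repeats? lp
  ... | yes (j , j<m , i , i<j , same) with repeat⇒shorter lp i<j j<m same
  ...   | _ , shorter , lp′ = recurse shorter lp′
  from-loop 2                   recurse lp | no norep = from-2-loop lp norep
  from-loop (suc (suc (suc e))) recurse lp | no norep = from-long-loop lp norep recurse

  dominating-cycle : DominatingCycle
  dominating-cycle = <-rec (λ m → Loop m → DominatingCycle) from-loop (proj₁ initial-loop) (proj₂ initial-loop)

mainTheorem6 : (G : Graph) → IsSimple G → Connected G →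
    IsCircularArcGraph G → ¬ IsIntervalGraph G →
    Σ (CycleIn G) λ C → Dominating G C × DiamLeDiam (asGraph C) G
mainTheorem6 G simple _ (L , nonZero , arc , model) notInterval =
  Argument.dominating-cycle G simple {L} {{nonZero}} arc model notInterval
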